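{- Let $M$ be a monoid with identity $1$, let $p\geq 2$, and let $\tau_1,\dots,\tau_{p-1}\in M$ satisfy $$\tau_i^2=1\quad (1\leq i\leq p-1),\qquad \tau_i\tau_j=\tau_j\tau_i\quad\text{if } |i-j|>1.$$ Define $$\delta=\tau_1\tau_2\cdots\tau_{p-1},$$ $$\gamma=\tau_1\tau_2\cdots\tau_{p-1}\cdot\tau_1\tau_2\cdots\tau_{p-2}\cdots\tau_1\tau_2\cdot\tau_1,$$ $$\gamma^*=\tau_{p-1}\tau_{p-2}\cdots\tau_1\cdot\tau_{p-1}\tau_{p-2}\cdots\tau_2\cdots\tau_{p-1}\tau_{p-2}\cdot\tau_{p-1}.$$ Then: (a) $\gamma^2=(\gamma^*)^2=1$; (b) $\delta^p=\gamma\gamma^*$; (c) $\delta\gamma=\gamma\delta^{ -1}$ (note $\delta$ is invertible since each $\tau_i$ is). -}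

module Defs where

open import Level using (Level)
open import Algebra.Bundles using (Monoid)
open import Data.Nat using (ℕ; zero; suc; _+_; _∸_)
open import Data.List using (List; []; _∷_; map; foldr; reverse; applyUpTo)

-- The list of naturals [a, a+1, ..., b] (empty if b < a).
fromTo : ℕ → ℕ → List ℕ
fromTo a b = applyUpTo (a +_) (suc b ∸ a)

module _ {c ℓ : Level} (M : Monoid c ℓ) where
  open Monoid M

  prod : List Carrier → Carrier
  prod = foldr _∙_ ε

  pow : Carrier → ℕ → Carrier
  pow x zero    = ε
  pow x (suc n) = x ∙ pow x n

  δ : ℕ → (ℕ → Carrier) → Carrier
  δ p τ = prod (map τ (fromTo 1 (p ∸ 1)))

  -- γ = (τ₁ ⋯ τ_{p-1})(τ₁ ⋯ τ_{p-2}) ⋯ (τ₁ τ₂)(τ₁)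
  γ : ℕ → (ℕ → Carrier) → Carrier
  γ p τ = prod (map (λ j → prod (map τ (fromTo 1 j))) (reverse (fromTo 1 (p ∸ 1))))

  -- γ* = (τ_{p-1} ⋯ τ₁)(τ_{p-1} ⋯ τ₂) ⋯ (τ_{p-1} τ_{p-2})(τ_{p-1})
  γ* : ℕ → (ℕ → Carrier) → Carrier
  γ* p τ = prod (map (λ k → prod (map τ (reverse (fromTo k (p ∸ 1))))) (fromTo 1 (p ∸ 1)))

-- Write δₘ = τ₁ ⋯ τₘ and γₘ = δₘ δₘ₋₁ ⋯ δ₁, so that δₘ₊₁ = δₘ τₘ₊₁ and γₘ₊₁ = δₘ₊₁ γₘ.
-- Being products of τ₁, …, τₘ, the elements δₘ, γₘ and τₘ τₘ₋₁ ⋯ τₖ commute with every y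
-- that commutes with τ₁, …, τₘ.  For y commuting with τ₁, …, τₘ₋₁ induction on m then gives
--   δₘ y γₘ = γₘ y δₘ⁻¹   and   (δₘ y)ᵐ⁺¹ = γₘ · (y τₘ⋯τ₁)(y τₘ⋯τ₂) ⋯ (y τₘ) y,
-- the step replacing y by τₘ₊₁ y, which still commutes with τ₁, …, τₘ₋₁ since the τᵢ commute at
-- distance ≥ 2.  Taking y = 1 gives (c) and (b); taking y = τₘ₊₁ in the first identity gives
-- γₘ₊₁ = γₘ δₘ₊₁⁻¹, whence γₘ₊₁² = γₘ² = 1.  Finally γ* = γ δᵖ by (b) and δ γ δ = γ by (c),
-- so (γ*)² = γ δᵖ γ δᵖ = γ² = 1.

module Submission where

open import Defs
open import Level using (Level; _⊔_)
open import Algebra.Bundles using (Monoid)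
open import Data.Nat using (ℕ; zero; suc; _+_; _∸_; _≤_; _<_; z≤n; s≤s; s≤s⁻¹)
open import Data.Nat.Properties
  using (≤-refl; ≤-trans; n≤1+n; m≤m+n; m∸n≤m; +-∸-assoc; m+[n∸m]≡n; m≤n⇒m∸n≡0; m≤o∸n⇒m+n≤o)
open import Data.List using (List; []; _∷_; _++_; _∷ʳ_; map; reverse; applyUpTo)
open import Data.List.Properties using (applyUpTo-∷ʳ; map-++; reverse-++; map-cong-local)
open import Data.List.Relation.Unary.All as All using (All; []; _∷_)
open import Data.List.Relation.Unary.All.Properties using (applyUpTo⁺₁; map⁺)
import Data.List.Relation.Unary.Any.Properties as Any
open import Data.Sum using (_⊎_; inj₁)
open import Data.Product using (_×_; _,_)
open import Function using (_∘_)
open import Relation.Binary.PropositionalEquality as ≡ using (_≡_)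
open import Tactic.MonoidSolver using (solve)

All-reverse : ∀ {a p} {A : Set a} {P : A → Set p} {xs : List A} → All P xs → All P (reverse xs)
All-reverse ps = All.tabulate (All.lookup ps ∘ Any.reverse⁻)

i<1+b∸a⇒a+i≤b : ∀ a b {i} → i < suc b ∸ a → a + i ≤ b
i<1+b∸a⇒a+i≤b zero          b       i<b+1 = s≤s⁻¹ i<b+1
i<1+b∸a⇒a+i≤b (suc zero)    zero    ()
i<1+b∸a⇒a+i≤b (suc (suc a)) zero    ()
i<1+b∸a⇒a+i≤b (suc a)       (suc b) i<    = s≤s (i<1+b∸a⇒a+i≤b a b i<)

fromTo-bounds : ∀ a b → All (λ k → a ≤ k × k ≤ b) (fromTo a b)
fromTo-bounds a b = applyUpTo⁺₁ (a +_) (suc b ∸ a) (λ {i} i< → m≤m+n a i , i<1+b∸a⇒a+i≤b a b i<)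

fromTo-empty : ∀ {a b} → b < a → fromTo a b ≡ []
fromTo-empty {a} b<a = ≡.cong (applyUpTo (a +_)) (m≤n⇒m∸n≡0 b<a)

fromTo-∷ʳ : ∀ {a} b → a ≤ suc b → fromTo a (suc b) ≡ fromTo a b ∷ʳ suc b
fromTo-∷ʳ {a} b a≤b+1 = begin
  applyUpTo (a +_) (suc (suc b) ∸ a)                    ≡⟨ ≡.cong (applyUpTo (a +_)) (+-∸-assoc 1 a≤b+1) ⟩
  applyUpTo (a +_) (suc (suc b ∸ a))                    ≡⟨ ≡.sym (applyUpTo-∷ʳ (a +_) (suc b ∸ a)) ⟩
  applyUpTo (a +_) (suc b ∸ a) ∷ʳ (a + (suc b ∸ a))      ≡⟨ ≡.cong (fromTo a b ∷ʳ_) (m+[n∸m]≡n a≤b+1) ⟩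
  fromTo a b ∷ʳ suc b                                   ∎
  where open ≡.≡-Reasoning

reverse-fromTo-suc : ∀ {a} b → a ≤ suc b → reverse (fromTo a (suc b)) ≡ suc b ∷ reverse (fromTo a b)
reverse-fromTo-suc {a} b a≤b+1 =
  ≡.trans (≡.cong reverse (fromTo-∷ʳ b a≤b+1)) (reverse-++ (fromTo a b) (suc b ∷ []))

module MonoidProperties {c ℓ : Level} (M : Monoid c ℓ) where
  open Monoid M
  open import Relation.Binary.Reasoning.Setoid setoid

  prod-++ : ∀ xs ys → prod M (xs ++ ys) ≈ prod M xs ∙ prod M ys
  prod-++ []       ys = sym (identityˡ _)
  prod-++ (x ∷ xs) ys = trans (∙-congˡ (prod-++ xs ys)) (sym (assoc _ _ _))

  prod-∷ʳ : ∀ xs x → prod M (xs ∷ʳ x) ≈ prod M xs ∙ x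
  prod-∷ʳ xs x = trans (prod-++ xs (x ∷ [])) (∙-congˡ (identityʳ x))

  prod-map-cong : ∀ {a} {A : Set a} {f g : A → Carrier} → (∀ x → f x ≈ g x) →
                  ∀ xs → prod M (map f xs) ≈ prod M (map g xs)
  prod-map-cong f≈g []       = refl
  prod-map-cong f≈g (x ∷ xs) = ∙-cong (f≈g x) (prod-map-cong f≈g xs)

  prod-closed : ∀ {p} {P : Carrier → Set p} → P ε → (∀ {a b} → P a → P b → P (a ∙ b)) →
                ∀ {xs} → All P xs → P (prod M xs)
  prod-closed Pε P∙ []         = Pε
  prod-closed Pε P∙ (px ∷ pxs) = P∙ px (prod-closed Pε P∙ pxs)

  pow-cong : ∀ {x y} k → x ≈ y → pow M x k ≈ pow M y k
  pow-cong zero    x≈y = refl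
  pow-cong (suc k) x≈y = ∙-cong x≈y (pow-cong k x≈y)

  pow-sucʳ : ∀ x k → pow M x (suc k) ≈ pow M x k ∙ x
  pow-sucʳ x zero    = trans (identityʳ x) (sym (identityˡ x))
  pow-sucʳ x (suc k) = trans (∙-congˡ (pow-sucʳ x k)) (sym (assoc _ _ _))

  pow-conj-fixed : ∀ {d x} → (d ∙ x) ∙ d ≈ x → ∀ k → (pow M d k ∙ x) ∙ pow M d k ≈ x
  pow-conj-fixed {d} {x} dxd≈x zero    = trans (identityʳ _) (identityˡ x)
  pow-conj-fixed {d} {x} dxd≈x (suc k) = begin
    (pow M d (suc k) ∙ x) ∙ pow M d (suc k)        ≈⟨ ∙-congˡ (pow-sucʳ d k) ⟩
    ((d ∙ pow M d k) ∙ x) ∙ (pow M d k ∙ d)        ≈⟨ solve M ⟩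
    (d ∙ ((pow M d k ∙ x) ∙ pow M d k)) ∙ d        ≈⟨ ∙-congʳ (∙-congˡ (pow-conj-fixed dxd≈x k)) ⟩
    (d ∙ x) ∙ d                                    ≈⟨ dxd≈x ⟩
    x                                              ∎

  leftInverse≈rightInverse : ∀ {x d e} → d ∙ x ≈ ε → x ∙ e ≈ ε → d ≈ e
  leftInverse≈rightInverse {x} {d} {e} dx≈ε xe≈ε = begin
    d            ≈⟨ sym (identityʳ d) ⟩
    d ∙ ε        ≈⟨ ∙-congˡ (sym xe≈ε) ⟩
    d ∙ (x ∙ e)  ≈⟨ sym (assoc d x e) ⟩
    (d ∙ x) ∙ e  ≈⟨ ∙-congʳ dx≈ε ⟩
    ε ∙ e        ≈⟨ identityˡ e ⟩
    e            ∎

  Commute : Carrier → Carrier → Set ℓ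
  Commute x y = x ∙ y ≈ y ∙ x

  commute-sym : ∀ {x y} → Commute x y → Commute y x
  commute-sym = sym

  commute-ε : ∀ x → Commute x ε
  commute-ε x = trans (identityʳ x) (sym (identityˡ x))

  commute-∙ : ∀ {x a b} → Commute x a → Commute x b → Commute x (a ∙ b)
  commute-∙ {x} {a} {b} xa≈ax xb≈bx = begin
    x ∙ (a ∙ b)  ≈⟨ sym (assoc x a b) ⟩
    (x ∙ a) ∙ b  ≈⟨ ∙-congʳ xa≈ax ⟩
    (a ∙ x) ∙ b  ≈⟨ assoc a x b ⟩
    a ∙ (x ∙ b)  ≈⟨ ∙-congˡ xb≈bx ⟩
    a ∙ (b ∙ x)  ≈⟨ sym (assoc a b x) ⟩
    (a ∙ b) ∙ x  ∎

  prod-slide : ∀ {a} {A : Set a} (g : A → Carrier) {y t z} ks → All (λ k → Commute (g k) y) ks →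
               prod M (map (λ k → y ∙ (t ∙ g k)) ks) ∙ (y ∙ z) ≈ y ∙ (prod M (map (λ k → (t ∙ y) ∙ g k) ks) ∙ z)
  prod-slide g {y} {t} {z} []       []          = trans (identityˡ _) (∙-congˡ (sym (identityˡ z)))
  prod-slide g {y} {t} {z} (k ∷ ks) (gy≈yg ∷ cs) = begin
    ((y ∙ (t ∙ g k)) ∙ P) ∙ (y ∙ z)       ≈⟨ assoc _ _ _ ⟩
    (y ∙ (t ∙ g k)) ∙ (P ∙ (y ∙ z))       ≈⟨ ∙-congˡ (prod-slide g ks cs) ⟩
    (y ∙ (t ∙ g k)) ∙ (y ∙ (P′ ∙ z))      ≈⟨ solve M ⟩
    y ∙ (t ∙ ((g k ∙ y) ∙ (P′ ∙ z)))      ≈⟨ ∙-congˡ (∙-congˡ (∙-congʳ gy≈yg)) ⟩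
    y ∙ (t ∙ ((y ∙ g k) ∙ (P′ ∙ z)))      ≈⟨ solve M ⟩
    y ∙ ((((t ∙ y) ∙ g k) ∙ P′) ∙ z)      ∎
    where
    P  = prod M (map (λ k → y ∙ (t ∙ g k)) ks)
    P′ = prod M (map (λ k → (t ∙ y) ∙ g k) ks)

module FarCommutingInvolutions
  {c ℓ : Level} (M : Monoid c ℓ) (τ : ℕ → Monoid.Carrier M) (n : ℕ)
  (τ-involutive : ∀ i → 1 ≤ i → i ≤ n → Monoid._≈_ M (Monoid._∙_ M (τ i) (τ i)) (Monoid.ε M))
  (τ-far-commute : ∀ i j → 1 ≤ i → i ≤ n → 1 ≤ j → j ≤ n → (i + 1 < j ⊎ j + 1 < i) →
                   Monoid._≈_ M (Monoid._∙_ M (τ i) (τ j)) (Monoid._∙_ M (τ j) (τ i)))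
  where

  open Monoid M
  open MonoidProperties M
  open import Relation.Binary.Reasoning.Setoid setoid

  δ[_] : ℕ → Carrier
  δ[ m ] = prod M (map τ (fromTo 1 m))

  δ⁻¹[_] : ℕ → Carrier
  δ⁻¹[ zero ]  = ε
  δ⁻¹[ suc m ] = τ (suc m) ∙ δ⁻¹[ m ]

  γ[_] : ℕ → Carrier
  γ[ m ] = prod M (map δ[_] (reverse (fromTo 1 m)))

  τ[_↓_] : ℕ → ℕ → Carrier
  τ[ m ↓ k ] = prod M (map τ (reverse (fromTo k m)))

  -- γ* with y interleaved: the generalisation of γ* that the induction for (b) runs on
  γ*[_∣_] : ℕ → Carrier → Carrier
  γ*[ m ∣ y ] = prod M (map (λ k → y ∙ τ[ m ↓ k ]) (fromTo 1 m)) ∙ y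

  δ-suc : ∀ m → δ[ suc m ] ≈ δ[ m ] ∙ τ (suc m)
  δ-suc m = begin
    prod M (map τ (fromTo 1 (suc m)))         ≡⟨ ≡.cong (prod M ∘ map τ) (fromTo-∷ʳ m (s≤s z≤n)) ⟩
    prod M (map τ (fromTo 1 m ∷ʳ suc m))      ≡⟨ ≡.cong (prod M) (map-++ τ (fromTo 1 m) (suc m ∷ [])) ⟩
    prod M (map τ (fromTo 1 m) ∷ʳ τ (suc m))  ≈⟨ prod-∷ʳ (map τ (fromTo 1 m)) (τ (suc m)) ⟩
    δ[ m ] ∙ τ (suc m)                        ∎

  γ-suc : ∀ m → γ[ suc m ] ≡ δ[ suc m ] ∙ γ[ m ]
  γ-suc m = ≡.cong (prod M ∘ map δ[_]) (reverse-fromTo-suc m (s≤s z≤n))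

  τ↓-suc : ∀ {m k} → k ≤ suc m → τ[ suc m ↓ k ] ≡ τ (suc m) ∙ τ[ m ↓ k ]
  τ↓-suc {m} k≤m+1 = ≡.cong (prod M ∘ map τ) (reverse-fromTo-suc m k≤m+1)

  τ↓-empty : ∀ m → τ[ m ↓ suc m ] ≡ ε
  τ↓-empty m = ≡.cong (prod M ∘ map τ ∘ reverse) (fromTo-empty {b = m} ≤-refl)

  InCentralizer : ℕ → Carrier → Set ℓ
  InCentralizer m y = ∀ i → 1 ≤ i → i ≤ m → Commute (τ i) y

  InBicommutant : ℕ → Carrier → Set (c ⊔ ℓ)
  InBicommutant m x = ∀ y → InCentralizer m y → Commute x y

  inCentralizer-anti : ∀ {j m y} → j ≤ m → InCentralizer m y → InCentralizer j y
  inCentralizer-anti j≤m y∈C i 1≤i i≤j = y∈C i 1≤i (≤-trans i≤j j≤m)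

  inCentralizer-ε : ∀ m → InCentralizer m ε
  inCentralizer-ε m i _ _ = commute-ε (τ i)

  inCentralizer-∙ : ∀ {m a b} → InCentralizer m a → InCentralizer m b → InCentralizer m (a ∙ b)
  inCentralizer-∙ a∈C b∈C i 1≤i i≤m = commute-∙ (a∈C i 1≤i i≤m) (b∈C i 1≤i i≤m)

  τ-inCentralizer : ∀ {m} → suc m ≤ n → InCentralizer (m ∸ 1) (τ (suc m))
  τ-inCentralizer {m} m+1≤n i 1≤i i≤m-1 =
    τ-far-commute i (suc m) 1≤i (≤-trans i≤m (≤-trans (n≤1+n m) m+1≤n)) (s≤s z≤n) m+1≤n
      (inj₁ (s≤s (m≤o∸n⇒m+n≤o i (≤-trans 1≤i i≤m) i≤m-1)))
    where i≤m = ≤-trans i≤m-1 (m∸n≤m m 1)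

  inBicommutant-mono : ∀ {j m x} → j ≤ m → InBicommutant j x → InBicommutant m x
  inBicommutant-mono j≤m x∈B y y∈C = x∈B y (inCentralizer-anti j≤m y∈C)

  inBicommutant-prod : ∀ {m xs} → All (InBicommutant m) xs → InBicommutant m (prod M xs)
  inBicommutant-prod = prod-closed
    (λ y _ → commute-sym (commute-ε y))
    (λ a∈B b∈B y y∈C → commute-sym (commute-∙ (commute-sym (a∈B y y∈C)) (commute-sym (b∈B y y∈C))))

  τ-inBicommutant : ∀ {i m} → 1 ≤ i → i ≤ m → InBicommutant m (τ i)
  τ-inBicommutant 1≤i i≤m y y∈C = y∈C _ 1≤i i≤m

  δ-inBicommutant : ∀ m → InBicommutant m δ[ m ]
  δ-inBicommutant m = inBicommutant-prod (map⁺
    (All.map (λ (1≤i , i≤m) → τ-inBicommutant 1≤i i≤m) (fromTo-bounds 1 m)))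

  γ-inBicommutant : ∀ m → InBicommutant m γ[ m ]
  γ-inBicommutant m = inBicommutant-prod (map⁺ (All-reverse
    (All.map (λ (_ , j≤m) → inBicommutant-mono j≤m (δ-inBicommutant _)) (fromTo-bounds 1 m))))

  τ↓-inBicommutant : ∀ {m k} → 1 ≤ k → InBicommutant m τ[ m ↓ k ]
  τ↓-inBicommutant {m} {k} 1≤k = inBicommutant-prod (map⁺ (All-reverse
    (All.map (λ (k≤i , i≤m) → τ-inBicommutant (≤-trans 1≤k k≤i) i≤m) (fromTo-bounds k m))))

  δ∙δ⁻¹≈ε : ∀ {m} → m ≤ n → δ[ m ] ∙ δ⁻¹[ m ] ≈ ε
  δ∙δ⁻¹≈ε {zero}  _      = identityˡ ε
  δ∙δ⁻¹≈ε {suc m} m+1≤n = begin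
    δ[ suc m ] ∙ (t ∙ δ⁻¹[ m ])       ≈⟨ ∙-congʳ (δ-suc m) ⟩
    (δ[ m ] ∙ t) ∙ (t ∙ δ⁻¹[ m ])     ≈⟨ solve M ⟩
    δ[ m ] ∙ ((t ∙ t) ∙ δ⁻¹[ m ])     ≈⟨ ∙-congˡ (∙-congʳ (τ-involutive (suc m) (s≤s z≤n) m+1≤n)) ⟩
    δ[ m ] ∙ (ε ∙ δ⁻¹[ m ])           ≈⟨ ∙-congˡ (identityˡ _) ⟩
    δ[ m ] ∙ δ⁻¹[ m ]                 ≈⟨ δ∙δ⁻¹≈ε (≤-trans (n≤1+n m) m+1≤n) ⟩
    ε                                 ∎
    where t = τ (suc m)

  δ⁻¹∙δ≈ε : ∀ {m} → m ≤ n → δ⁻¹[ m ] ∙ δ[ m ] ≈ ε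
  δ⁻¹∙δ≈ε {zero}  _      = identityˡ ε
  δ⁻¹∙δ≈ε {suc m} m+1≤n = begin
    (t ∙ δ⁻¹[ m ]) ∙ δ[ suc m ]       ≈⟨ ∙-congˡ (δ-suc m) ⟩
    (t ∙ δ⁻¹[ m ]) ∙ (δ[ m ] ∙ t)     ≈⟨ solve M ⟩
    t ∙ ((δ⁻¹[ m ] ∙ δ[ m ]) ∙ t)     ≈⟨ ∙-congˡ (∙-congʳ (δ⁻¹∙δ≈ε (≤-trans (n≤1+n m) m+1≤n))) ⟩
    t ∙ (ε ∙ t)                       ≈⟨ ∙-congˡ (identityˡ t) ⟩
    t ∙ t                             ≈⟨ τ-involutive (suc m) (s≤s z≤n) m+1≤n ⟩
    ε                                 ∎
    where t = τ (suc m)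

  δy∙γ≈γy∙δ⁻¹ : ∀ {m y} → m ≤ n → InCentralizer (m ∸ 1) y →
                (δ[ m ] ∙ y) ∙ γ[ m ] ≈ (γ[ m ] ∙ y) ∙ δ⁻¹[ m ]
  δy∙γ≈γy∙δ⁻¹ {zero}      _      _   = refl
  δy∙γ≈γy∙δ⁻¹ {suc m} {y} m+1≤n y∈C = begin
    (δ[ suc m ] ∙ y) ∙ γ[ suc m ]                      ≡⟨ ≡.cong ((δ[ suc m ] ∙ y) ∙_) (γ-suc m) ⟩
    (δ[ suc m ] ∙ y) ∙ (δ[ suc m ] ∙ γ[ m ])           ≈⟨ ∙-cong (∙-congʳ (δ-suc m)) (∙-congʳ (δ-suc m)) ⟩
    ((δ[ m ] ∙ t) ∙ y) ∙ ((δ[ m ] ∙ t) ∙ γ[ m ])       ≈⟨ solve M ⟩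
    (δ[ m ] ∙ t) ∙ ((y ∙ δ[ m ]) ∙ (t ∙ γ[ m ]))       ≈⟨ ∙-congˡ (∙-congʳ (sym (δ-inBicommutant m y y∈C))) ⟩
    (δ[ m ] ∙ t) ∙ ((δ[ m ] ∙ y) ∙ (t ∙ γ[ m ]))       ≈⟨ solve M ⟩
    (δ[ m ] ∙ t) ∙ ((δ[ m ] ∙ (y ∙ t)) ∙ γ[ m ])       ≈⟨ ∙-congˡ (δy∙γ≈γy∙δ⁻¹ m≤n yt∈C) ⟩
    (δ[ m ] ∙ t) ∙ ((γ[ m ] ∙ (y ∙ t)) ∙ δ⁻¹[ m ])     ≈⟨ solve M ⟩
    (((δ[ m ] ∙ t) ∙ γ[ m ]) ∙ y) ∙ (t ∙ δ⁻¹[ m ])     ≈⟨ ∙-congʳ (∙-congʳ (∙-congʳ (sym (δ-suc m)))) ⟩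
    ((δ[ suc m ] ∙ γ[ m ]) ∙ y) ∙ δ⁻¹[ suc m ]         ≡⟨ ≡.cong (λ g → (g ∙ y) ∙ δ⁻¹[ suc m ]) (≡.sym (γ-suc m)) ⟩
    (γ[ suc m ] ∙ y) ∙ δ⁻¹[ suc m ]                    ∎
    where
    t = τ (suc m)
    m≤n = ≤-trans (n≤1+n m) m+1≤n
    yt∈C = inCentralizer-∙ (inCentralizer-anti (m∸n≤m m 1) y∈C) (τ-inCentralizer m+1≤n)

  γ-sucʳ : ∀ {m} → suc m ≤ n → γ[ suc m ] ≈ γ[ m ] ∙ δ⁻¹[ suc m ]
  γ-sucʳ {m} m+1≤n = begin
    γ[ suc m ]                   ≡⟨ γ-suc m ⟩
    δ[ suc m ] ∙ γ[ m ]          ≈⟨ ∙-congʳ (δ-suc m) ⟩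
    (δ[ m ] ∙ t) ∙ γ[ m ]        ≈⟨ δy∙γ≈γy∙δ⁻¹ (≤-trans (n≤1+n m) m+1≤n) (τ-inCentralizer m+1≤n) ⟩
    (γ[ m ] ∙ t) ∙ δ⁻¹[ m ]      ≈⟨ assoc _ _ _ ⟩
    γ[ m ] ∙ δ⁻¹[ suc m ]        ∎
    where t = τ (suc m)

  γ∙γ≈ε : ∀ {m} → m ≤ n → γ[ m ] ∙ γ[ m ] ≈ ε
  γ∙γ≈ε {zero}  _      = identityˡ ε
  γ∙γ≈ε {suc m} m+1≤n = begin
    γ[ suc m ] ∙ γ[ suc m ]                                ≈⟨ ∙-congʳ (γ-sucʳ m+1≤n) ⟩
    (γ[ m ] ∙ δ⁻¹[ suc m ]) ∙ γ[ suc m ]                   ≡⟨ ≡.cong ((γ[ m ] ∙ δ⁻¹[ suc m ]) ∙_) (γ-suc m) ⟩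
    (γ[ m ] ∙ δ⁻¹[ suc m ]) ∙ (δ[ suc m ] ∙ γ[ m ])        ≈⟨ solve M ⟩
    γ[ m ] ∙ ((δ⁻¹[ suc m ] ∙ δ[ suc m ]) ∙ γ[ m ])        ≈⟨ ∙-congˡ (∙-congʳ (δ⁻¹∙δ≈ε m+1≤n)) ⟩
    γ[ m ] ∙ (ε ∙ γ[ m ])                                  ≈⟨ ∙-congˡ (identityˡ _) ⟩
    γ[ m ] ∙ γ[ m ]                                        ≈⟨ γ∙γ≈ε (≤-trans (n≤1+n m) m+1≤n) ⟩
    ε                                                      ∎

  γ*-suc : ∀ {m y} → InCentralizer m y → γ*[ suc m ∣ y ] ≈ y ∙ γ*[ m ∣ τ (suc m) ∙ y ]
  γ*-suc {m} {y} y∈C = begin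
    prod M (map g (fromTo 1 (suc m))) ∙ y                           ≡⟨ ≡.cong (λ l → prod M (map g l) ∙ y) (fromTo-∷ʳ m (s≤s z≤n)) ⟩
    prod M (map g (fromTo 1 m ∷ʳ suc m)) ∙ y                        ≡⟨ ≡.cong (λ l → prod M l ∙ y) (map-++ g (fromTo 1 m) (suc m ∷ [])) ⟩
    prod M (map g (fromTo 1 m) ∷ʳ g (suc m)) ∙ y                    ≈⟨ ∙-congʳ (prod-∷ʳ (map g (fromTo 1 m)) (g (suc m))) ⟩
    (prod M (map g (fromTo 1 m)) ∙ (y ∙ τ[ suc m ↓ suc m ])) ∙ y    ≡⟨ ≡.cong₂ (λ l r → (prod M l ∙ (y ∙ r)) ∙ y) g≡yt↓ τ↓-top ⟩
    (prod M (map (λ k → y ∙ (t ∙ τ[ m ↓ k ])) (fromTo 1 m)) ∙ (y ∙ (t ∙ ε))) ∙ y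
                                                                    ≈⟨ solve M ⟩
    prod M (map (λ k → y ∙ (t ∙ τ[ m ↓ k ])) (fromTo 1 m)) ∙ (y ∙ (t ∙ y))
                                                                    ≈⟨ prod-slide τ[ m ↓_] (fromTo 1 m) commutes ⟩
    y ∙ γ*[ m ∣ t ∙ y ]                                             ∎
    where
    t = τ (suc m)
    g = λ k → y ∙ τ[ suc m ↓ k ]
    g≡yt↓ : map g (fromTo 1 m) ≡ map (λ k → y ∙ (t ∙ τ[ m ↓ k ])) (fromTo 1 m)
    g≡yt↓ = map-cong-local (All.map (λ (_ , k≤m) → ≡.cong (y ∙_) (τ↓-suc (≤-trans k≤m (n≤1+n m)))) (fromTo-bounds 1 m))
    τ↓-top : τ[ suc m ↓ suc m ] ≡ t ∙ ε
    τ↓-top = ≡.trans (τ↓-suc ≤-refl) (≡.cong (t ∙_) (τ↓-empty m))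
    commutes : All (λ k → Commute τ[ m ↓ k ] y) (fromTo 1 m)
    commutes = All.map (λ (1≤k , _) → τ↓-inBicommutant 1≤k y y∈C) (fromTo-bounds 1 m)

  pow-δy≈γ∙γ* : ∀ {m y} → m ≤ n → InCentralizer (m ∸ 1) y → pow M (δ[ m ] ∙ y) (suc m) ≈ γ[ m ] ∙ γ*[ m ∣ y ]
  pow-δy≈γ∙γ* {zero}      _      _   = solve M
  pow-δy≈γ∙γ* {suc m} {y} m+1≤n y∈C = begin
    pow M (δ[ suc m ] ∙ y) (suc (suc m))              ≈⟨ pow-cong (suc (suc m)) (trans (∙-congʳ (δ-suc m)) (assoc _ _ _)) ⟩
    (δ[ m ] ∙ z) ∙ pow M (δ[ m ] ∙ z) (suc m)         ≈⟨ ∙-congˡ (pow-δy≈γ∙γ* (≤-trans (n≤1+n m) m+1≤n) z∈C) ⟩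
    (δ[ m ] ∙ (t ∙ y)) ∙ (γ[ m ] ∙ γ*[ m ∣ z ])       ≈⟨ solve M ⟩
    (δ[ m ] ∙ t) ∙ ((y ∙ γ[ m ]) ∙ γ*[ m ∣ z ])       ≈⟨ ∙-congˡ (∙-congʳ (sym (γ-inBicommutant m y y∈C))) ⟩
    (δ[ m ] ∙ t) ∙ ((γ[ m ] ∙ y) ∙ γ*[ m ∣ z ])       ≈⟨ solve M ⟩
    ((δ[ m ] ∙ t) ∙ γ[ m ]) ∙ (y ∙ γ*[ m ∣ z ])       ≈⟨ ∙-cong (∙-congʳ (sym (δ-suc m))) (sym (γ*-suc y∈C)) ⟩
    (δ[ suc m ] ∙ γ[ m ]) ∙ γ*[ suc m ∣ y ]           ≡⟨ ≡.cong (_∙ γ*[ suc m ∣ y ]) (≡.sym (γ-suc m)) ⟩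
    γ[ suc m ] ∙ γ*[ suc m ∣ y ]                      ∎
    where
    t = τ (suc m)
    z = t ∙ y
    z∈C = inCentralizer-∙ (τ-inCentralizer m+1≤n) (inCentralizer-anti (m∸n≤m m 1) y∈C)

  γ*[∣ε]≈γ* : γ*[ n ∣ ε ] ≈ γ* M (suc n) τ
  γ*[∣ε]≈γ* = trans (identityʳ _) (prod-map-cong (λ k → identityˡ τ[ n ↓ k ]) (fromTo 1 n))

  δ^[1+n]≈γ∙γ* : pow M δ[ n ] (suc n) ≈ γ[ n ] ∙ γ* M (suc n) τ
  δ^[1+n]≈γ∙γ* = begin
    pow M δ[ n ] (suc n)          ≈⟨ pow-cong (suc n) (sym (identityʳ δ[ n ])) ⟩
    pow M (δ[ n ] ∙ ε) (suc n)    ≈⟨ pow-δy≈γ∙γ* ≤-refl (inCentralizer-ε (n ∸ 1)) ⟩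
    γ[ n ] ∙ γ*[ n ∣ ε ]          ≈⟨ ∙-congˡ γ*[∣ε]≈γ* ⟩
    γ[ n ] ∙ γ* M (suc n) τ       ∎

  δ∙γ≈γ∙δ⁻¹ : δ[ n ] ∙ γ[ n ] ≈ γ[ n ] ∙ δ⁻¹[ n ]
  δ∙γ≈γ∙δ⁻¹ = begin
    δ[ n ] ∙ γ[ n ]               ≈⟨ ∙-congʳ (sym (identityʳ δ[ n ])) ⟩
    (δ[ n ] ∙ ε) ∙ γ[ n ]         ≈⟨ δy∙γ≈γy∙δ⁻¹ ≤-refl (inCentralizer-ε (n ∸ 1)) ⟩
    (γ[ n ] ∙ ε) ∙ δ⁻¹[ n ]       ≈⟨ ∙-congʳ (identityʳ γ[ n ]) ⟩
    γ[ n ] ∙ δ⁻¹[ n ]             ∎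

  δ∙γ∙δ≈γ : (δ[ n ] ∙ γ[ n ]) ∙ δ[ n ] ≈ γ[ n ]
  δ∙γ∙δ≈γ = begin
    (δ[ n ] ∙ γ[ n ]) ∙ δ[ n ]     ≈⟨ ∙-congʳ δ∙γ≈γ∙δ⁻¹ ⟩
    (γ[ n ] ∙ δ⁻¹[ n ]) ∙ δ[ n ]   ≈⟨ assoc _ _ _ ⟩
    γ[ n ] ∙ (δ⁻¹[ n ] ∙ δ[ n ])   ≈⟨ ∙-congˡ (δ⁻¹∙δ≈ε ≤-refl) ⟩
    γ[ n ] ∙ ε                     ≈⟨ identityʳ γ[ n ] ⟩
    γ[ n ]                         ∎

  γ*∙γ*≈ε : γ* M (suc n) τ ∙ γ* M (suc n) τ ≈ ε
  γ*∙γ*≈ε = begin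
    γ* M (suc n) τ ∙ γ* M (suc n) τ    ≈⟨ ∙-cong γ*≈γ∙δ^[1+n] γ*≈γ∙δ^[1+n] ⟩
    (γ[ n ] ∙ δ^[1+n]) ∙ (γ[ n ] ∙ δ^[1+n])   ≈⟨ solve M ⟩
    γ[ n ] ∙ ((δ^[1+n] ∙ γ[ n ]) ∙ δ^[1+n])   ≈⟨ ∙-congˡ (pow-conj-fixed δ∙γ∙δ≈γ (suc n)) ⟩
    γ[ n ] ∙ γ[ n ]                           ≈⟨ γ∙γ≈ε ≤-refl ⟩
    ε                                         ∎
    where
    δ^[1+n] = pow M δ[ n ] (suc n)
    γ*≈γ∙δ^[1+n] : γ* M (suc n) τ ≈ γ[ n ] ∙ δ^[1+n]
    γ*≈γ∙δ^[1+n] = begin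
      γ* M (suc n) τ                       ≈⟨ sym (identityˡ _) ⟩
      ε ∙ γ* M (suc n) τ                   ≈⟨ ∙-congʳ (sym (γ∙γ≈ε ≤-refl)) ⟩
      (γ[ n ] ∙ γ[ n ]) ∙ γ* M (suc n) τ   ≈⟨ assoc _ _ _ ⟩
      γ[ n ] ∙ (γ[ n ] ∙ γ* M (suc n) τ)   ≈⟨ ∙-congˡ (sym δ^[1+n]≈γ∙γ*) ⟩
      γ[ n ] ∙ δ^[1+n]                     ∎

  δ∙γ≈γ∙leftInverse : ∀ {d} → d ∙ δ[ n ] ≈ ε → δ[ n ] ∙ γ[ n ] ≈ γ[ n ] ∙ d
  δ∙γ≈γ∙leftInverse d∙δ≈ε =
    trans δ∙γ≈γ∙δ⁻¹ (∙-congˡ (sym (leftInverse≈rightInverse d∙δ≈ε (δ∙δ⁻¹≈ε ≤-refl))))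

lemma2p2 : ∀ {c ℓ : Level} (M : Monoid c ℓ) (p : ℕ) → 2 ≤ p →
    (τ : ℕ → Monoid.Carrier M) →
    (∀ i → 1 ≤ i → i ≤ p ∸ 1 → Monoid._≈_ M (Monoid._∙_ M (τ i) (τ i)) (Monoid.ε M)) →
    (∀ i j → 1 ≤ i → i ≤ p ∸ 1 → 1 ≤ j → j ≤ p ∸ 1 → (i + 1 < j ⊎ j + 1 < i) →
    Monoid._≈_ M (Monoid._∙_ M (τ i) (τ j)) (Monoid._∙_ M (τ j) (τ i))) →
    let open Monoid M in
    ((γ M p τ ∙ γ M p τ ≈ ε) × (γ* M p τ ∙ γ* M p τ ≈ ε))
    × (pow M (δ M p τ) p ≈ γ M p τ ∙ γ* M p τ)
    × (∀ (d : Carrier) → d ∙ δ M p τ ≈ ε → δ M p τ ∙ d ≈ ε →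
    δ M p τ ∙ γ M p τ ≈ γ M p τ ∙ d)
lemma2p2 M zero    ()
lemma2p2 M (suc n) _  τ τ-involutive τ-far-commute =
  (γ∙γ≈ε ≤-refl , γ*∙γ*≈ε) , δ^[1+n]≈γ∙γ* , λ d d∙δ≈ε _ → δ∙γ≈γ∙leftInverse d∙δ≈ε
  where open FarCommutingInvolutions M τ n τ-involutive τ-far-commute
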